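{- For every integer $n\ge0$ let $r_n\in\{0,1\}$ be the parity of the number of runs (maximal blocks of consecutive digits) of $1$'s in the binary representation of $n$. Then the infinite sequence $R=(r_n)_{n\ge0}$ is quint-free: there is no nonempty finite word $X$ over $\{0,1\}$ such that $XXXXX$ occurs in $R$ as a block of consecutive terms.
   Context: The binary representation of $0$ contains no $1$'s, so it has zero runs of $1$'s. -}

module Defs where

open import Data.Nat using (ℕ; zero; suc; _+_; _*_; _<_)
open import Data.Nat.DivMod using (_/_; _%_)
open import Data.Nat.Properties using (_≟_)
open import Data.Bool using (Bool; true; false; not; _xor_)
open import Data.List using (List; []; _∷_; length; _++_)
open import Data.Fin using (Fin; toℕ)
open import Data.List.Base using (lookup)
open import Relation.Nullary using (¬_)
open import Relation.Binary.PropositionalEquality using (_≡_)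
open import Data.Product using (∃-syntax; _×_)

-- Binary digits of n, least significant first, with fuel (fuel n suffices,
-- since n ≥ 2^(number of digits) - 1). 0 has the empty representation.
bitsFuel : ℕ → ℕ → List Bool
bitsFuel zero    n       = []
bitsFuel (suc f) zero    = []
bitsFuel (suc f) (suc m) = isOne ((suc m) % 2) ∷ bitsFuel f ((suc m) / 2)
  where
  isOne : ℕ → Bool
  isOne 1 = true
  isOne _ = false

bits : ℕ → List Bool
bits n = bitsFuel n n

runsAux : Bool → List Bool → ℕ
runsAux prev []           = 0
runsAux prev (true ∷ bs)  = (if' prev then 0 else 1) + runsAux true bs
  where
  if'_then_else_ : Bool → ℕ → ℕ → ℕ
  if' true  then a else b = a
  if' false then a else b = b
runsAux prev (false ∷ bs) = runsAux false bs

runsOfOnes : ℕ → ℕ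
runsOfOnes n = runsAux false (bits n)

parity : ℕ → Bool
parity zero    = false
parity (suc k) = not (parity k)

r : ℕ → Bool
r n = parity (runsOfOnes n)

OccursAt : (ℕ → Bool) → List Bool → ℕ → Set
OccursAt s w i = (j : Fin (length w)) → s (i + toℕ j) ≡ lookup w j

fifthPower : List Bool → List Bool
fifthPower X = X ++ X ++ X ++ X ++ X

QuintFree : (ℕ → Bool) → Set
QuintFree s = ¬ (∃[ X ] (¬ (X ≡ [])) × ∃[ i ] OccursAt s (fifthPower X) i)

-- From the binary expansion, r (2n) = r n, r (4k+1) = not (r k) and r (4k+3) = r (2k+1).
-- A fifth power of a word of length p at position i makes r a = r (a + p) for all
-- a ∈ [i, i + 4p). For even p, halving the positions yields such a window for p/2, so by
-- strong induction it suffices to exclude odd p. Then the first difference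
-- Δ r n = r n xor r (n+1) is also p-periodic on the window; but Δ r is true on 4k and 8k+5
-- and false on 4k+2 and 8k+1, and for odd p ≥ 3 the window contains a position a with
-- a ≡ 0, 2, 4 or 6 (mod 8) chosen so that a and a + p fall into classes of opposite value.
-- Period 1 contradicts r (4k) ≠ r (4k+1) directly.

module Submission where

open import Data.Bool using (Bool; true; false; not; _xor_)
open import Data.Bool.Properties using (not-¬; xor-same; not-distribˡ-xor; not-distribʳ-xor)
open import Data.Fin using (Fin; zero; suc; toℕ; fromℕ<)
open import Data.Fin.Properties using (toℕ-fromℕ<)
open import Data.List using (List; []; _∷_; length; _++_; lookup)
open import Data.List.Properties using (length-++; ++-assoc)
open import Data.Nat using (ℕ; zero; suc; _+_; _*_; _∸_; _<_; _≤_; z≤n; s≤s; ⌈_/2⌉)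
open import Data.Nat.Divisibility using (n∣m*n)
open import Data.Nat.DivMod
open import Data.Nat.Induction using (<-rec)
open import Data.Nat.Properties
open import Data.Nat.Tactic.RingSolver using (solve-∀)
open import Data.Product using (∃-syntax; _×_; _,_)
open import Data.Sum using (inj₁; inj₂)
open import Relation.Binary.PropositionalEquality
open import Relation.Nullary using (¬_)

open import Defs

bitsFuel-zero : ∀ f → bitsFuel f 0 ≡ []
bitsFuel-zero zero    = refl
bitsFuel-zero (suc f) = refl

bitsFuel-irrelevant : ∀ {f g} n → n ≤ f → n ≤ g → bitsFuel f n ≡ bitsFuel g n
bitsFuel-irrelevant {f} {g} zero _ _ = trans (bitsFuel-zero f) (sym (bitsFuel-zero g))
-- The leading digit is computed by a function local to bitsFuel, hence depends on the fuel
-- until `suc m % 2` is a constructor.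
bitsFuel-irrelevant (suc m) (s≤s m≤f) (s≤s m≤g)
  with suc m % 2 | bitsFuel-irrelevant (suc m / 2) (≤-trans half≤m m≤f) (≤-trans half≤m m≤g)
  where
  half≤m : suc m / 2 ≤ m
  half≤m = ≤-pred (m/n<m (suc m) 2 (s≤s (s≤s z≤n)))
... | zero        | tails = cong (false ∷_) tails
... | suc zero    | tails = cong (true ∷_) tails
... | suc (suc _) | tails = cong (false ∷_) tails

bitsFuel-even : ∀ f m → suc m % 2 ≡ 0 → bitsFuel (suc f) (suc m) ≡ false ∷ bitsFuel f (suc m / 2)
bitsFuel-even f m eq rewrite eq = refl

bitsFuel-odd : ∀ f m → suc m % 2 ≡ 1 → bitsFuel (suc f) (suc m) ≡ true ∷ bitsFuel f (suc m / 2)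
bitsFuel-odd f m eq rewrite eq = refl

bits-2[1+n] : ∀ n → bits (suc n * 2) ≡ false ∷ bits (suc n)
bits-2[1+n] n = begin
  bits (suc n * 2)                                 ≡⟨ bitsFuel-even (suc (n * 2)) (suc (n * 2)) (m*n%n≡0 (suc n) 2) ⟩
  false ∷ bitsFuel (suc (n * 2)) (suc n * 2 / 2)   ≡⟨ cong (λ m → false ∷ bitsFuel (suc (n * 2)) m) (m*n/n≡m (suc n) 2) ⟩
  false ∷ bitsFuel (suc (n * 2)) (suc n)           ≡⟨ cong (false ∷_) (bitsFuel-irrelevant (suc n) (s≤s (m≤m*n n 2)) ≤-refl) ⟩
  false ∷ bits (suc n)                             ∎
  where open ≡-Reasoning

bits-2n+1 : ∀ n → bits (1 + n * 2) ≡ true ∷ bits n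
bits-2n+1 n = begin
  bits (1 + n * 2)                           ≡⟨ bitsFuel-odd (n * 2) (n * 2) ([m+kn]%n≡m%n 1 n 2) ⟩
  true ∷ bitsFuel (n * 2) ((1 + n * 2) / 2)  ≡⟨ cong (λ m → true ∷ bitsFuel (n * 2) m) half ⟩
  true ∷ bitsFuel (n * 2) n                  ≡⟨ cong (true ∷_) (bitsFuel-irrelevant n (m≤m*n n 2) ≤-refl) ⟩
  true ∷ bits n                              ∎
  where
  open ≡-Reasoning
  half : (1 + n * 2) / 2 ≡ n
  half = trans (+-distrib-/-∣ʳ 1 {d = 2} (n∣m*n n)) (m*n/n≡m n 2)

runsAux-true-2n : ∀ n → runsAux true (bits (n * 2)) ≡ runsOfOnes (n * 2)
runsAux-true-2n zero = refl
runsAux-true-2n (suc n) rewrite bits-2[1+n] n = refl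

runsOfOnes-2n : ∀ n → runsOfOnes (n * 2) ≡ runsOfOnes n
runsOfOnes-2n zero    = refl
runsOfOnes-2n (suc n) = cong (runsAux false) (bits-2[1+n] n)

runsOfOnes-4k+1 : ∀ k → runsOfOnes (1 + k * 4) ≡ suc (runsOfOnes k)
runsOfOnes-4k+1 k = begin
  runsOfOnes (1 + k * 4)             ≡⟨ cong (λ m → runsOfOnes (1 + m)) (*-assoc k 2 2) ⟨
  runsOfOnes (1 + k * 2 * 2)         ≡⟨ cong (runsAux false) (bits-2n+1 (k * 2)) ⟩
  suc (runsAux true (bits (k * 2)))  ≡⟨ cong suc (runsAux-true-2n k) ⟩
  suc (runsOfOnes (k * 2))           ≡⟨ cong suc (runsOfOnes-2n k) ⟩
  suc (runsOfOnes k)                 ∎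
  where open ≡-Reasoning

runsOfOnes-4k+3 : ∀ k → runsOfOnes (3 + k * 4) ≡ runsOfOnes (1 + k * 2)
runsOfOnes-4k+3 k = begin
  runsOfOnes (3 + k * 4)                  ≡⟨ cong (λ m → runsOfOnes (3 + m)) (*-assoc k 2 2) ⟨
  runsOfOnes (1 + (1 + k * 2) * 2)        ≡⟨ cong (runsAux false) (bits-2n+1 (1 + k * 2)) ⟩
  runsAux false (true ∷ bits (1 + k * 2)) ≡⟨ cong (λ bs → runsAux false (true ∷ bs)) (bits-2n+1 k) ⟩
  runsAux false (true ∷ true ∷ bits k)    ≡⟨ cong (runsAux false) (bits-2n+1 k) ⟨
  runsOfOnes (1 + k * 2)                  ∎
  where open ≡-Reasoning

r-2n : ∀ n → r (n * 2) ≡ r n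
r-2n n = cong parity (runsOfOnes-2n n)

r-4k : ∀ k → r (k * 4) ≡ r k
r-4k k = trans (cong r (sym (*-assoc k 2 2))) (trans (r-2n (k * 2)) (r-2n k))

r-4k+1 : ∀ k → r (1 + k * 4) ≡ not (r k)
r-4k+1 k = cong parity (runsOfOnes-4k+1 k)

r-4k+3 : ∀ k → r (3 + k * 4) ≡ r (1 + k * 2)
r-4k+3 k = cong parity (runsOfOnes-4k+3 k)

Δ : (ℕ → Bool) → ℕ → Bool
Δ s n = s n xor s (suc n)

Δr-4k : ∀ k → Δ r (k * 4) ≡ true
Δr-4k k = begin
  r (k * 4) xor r (1 + k * 4)  ≡⟨ cong₂ _xor_ (r-4k k) (r-4k+1 k) ⟩
  r k xor not (r k)            ≡⟨ not-distribʳ-xor (r k) (r k) ⟨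
  not (r k xor r k)            ≡⟨ cong not (xor-same (r k)) ⟩
  true                         ∎
  where open ≡-Reasoning

Δr-4k+2 : ∀ k → Δ r (2 + k * 4) ≡ false
Δr-4k+2 k = begin
  r (2 + k * 4) xor r (3 + k * 4)       ≡⟨ cong (λ m → r (2 + m) xor r (3 + k * 4)) (*-assoc k 2 2) ⟨
  r ((1 + k * 2) * 2) xor r (3 + k * 4) ≡⟨ cong₂ _xor_ (r-2n (1 + k * 2)) (r-4k+3 k) ⟩
  r (1 + k * 2) xor r (1 + k * 2)       ≡⟨ xor-same (r (1 + k * 2)) ⟩
  false                                 ∎
  where open ≡-Reasoning

Δr-8k+1 : ∀ k → Δ r (1 + k * 8) ≡ false
Δr-8k+1 k = begin
  r (1 + k * 8) xor r (2 + k * 8)                ≡⟨ cong₂ (λ m n → r (1 + m) xor r (2 + n)) (*-assoc k 2 4) (*-assoc k 4 2) ⟨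
  r (1 + k * 2 * 4) xor r ((1 + k * 4) * 2)      ≡⟨ cong₂ _xor_ (r-4k+1 (k * 2)) (r-2n (1 + k * 4)) ⟩
  not (r (k * 2)) xor r (1 + k * 4)              ≡⟨ cong₂ (λ x y → not x xor y) (r-2n k) (r-4k+1 k) ⟩
  not (r k) xor not (r k)                        ≡⟨ xor-same (not (r k)) ⟩
  false                                          ∎
  where open ≡-Reasoning

Δr-8k+5 : ∀ k → Δ r (5 + k * 8) ≡ true
Δr-8k+5 k = begin
  r (5 + k * 8) xor r (6 + k * 8)                ≡⟨ cong₂ (λ m n → r (5 + m) xor r (6 + n)) (*-assoc k 2 4) (*-assoc k 4 2) ⟨
  r (1 + (1 + k * 2) * 4) xor r ((3 + k * 4) * 2) ≡⟨ cong₂ _xor_ (r-4k+1 (1 + k * 2)) (r-2n (3 + k * 4)) ⟩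
  not (r (1 + k * 2)) xor r (3 + k * 4)          ≡⟨ cong (not (r (1 + k * 2)) xor_) (r-4k+3 k) ⟩
  not (r (1 + k * 2)) xor r (1 + k * 2)          ≡⟨ not-distribˡ-xor (r (1 + k * 2)) (r (1 + k * 2)) ⟨
  not (r (1 + k * 2) xor r (1 + k * 2))          ≡⟨ cong not (xor-same (r (1 + k * 2))) ⟩
  true                                           ∎
  where open ≡-Reasoning

Periodic : (ℕ → Bool) → ℕ → ℕ → Set
Periodic s p i = ∀ a → i ≤ a → a < i + 4 * p → s a ≡ s (a + p)

OccursAt-tail : ∀ {s x w i} → OccursAt s (x ∷ w) i → OccursAt s w (suc i)
OccursAt-tail {s} {i = i} occ j = trans (cong s (sym (+-suc i (toℕ j)))) (occ (suc j))

OccursAt-++ˡ : ∀ {s} X {Y i} → OccursAt s (X ++ Y) i → OccursAt s X i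
OccursAt-++ˡ (x ∷ X) occ zero = occ zero
OccursAt-++ˡ {s} (x ∷ X) {i = i} occ (suc j) =
  trans (cong s (+-suc i (toℕ j))) (OccursAt-++ˡ {s} X (OccursAt-tail {s} occ) j)

OccursAt-++ʳ : ∀ {s} X {Y i} → OccursAt s (X ++ Y) i → OccursAt s Y (i + length X)
OccursAt-++ʳ {s} [] {i = i} occ j = trans (cong (λ m → s (m + toℕ j)) (+-identityʳ i)) (occ j)
OccursAt-++ʳ {s} (x ∷ X) {i = i} occ j =
  trans (cong (λ m → s (m + toℕ j)) (+-suc i (length X))) (OccursAt-++ʳ {s} X (OccursAt-tail {s} occ) j)

occurs-twice⇒shift-invariant : ∀ {s} w {i p} → OccursAt s w i → OccursAt s w (i + p) →
                               ∀ a → i ≤ a → a < i + length w → s a ≡ s (a + p)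
occurs-twice⇒shift-invariant {s} w {i} {p} occ occ′ a i≤a a<i+|w| = begin
  s a                  ≡⟨ cong s i+d≡a ⟨
  s (i + toℕ j)        ≡⟨ occ j ⟩
  lookup w j           ≡⟨ occ′ j ⟨
  s (i + p + toℕ j)    ≡⟨ cong s (swap i p (toℕ j)) ⟩
  s (i + toℕ j + p)    ≡⟨ cong (λ m → s (m + p)) i+d≡a ⟩
  s (a + p)            ∎
  where
  open ≡-Reasoning
  swap : ∀ i p d → i + p + d ≡ i + d + p
  swap = solve-∀
  d<|w| : a ∸ i < length w
  d<|w| = +-cancelˡ-< i (a ∸ i) (length w) (subst (_< i + length w) (sym (m+[n∸m]≡n i≤a)) a<i+|w|)
  j : Fin (length w)
  j = fromℕ< d<|w|
  i+d≡a : i + toℕ j ≡ a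
  i+d≡a = trans (cong (i +_) (toℕ-fromℕ< d<|w|)) (m+[n∸m]≡n i≤a)

fifthPower⇒periodic : ∀ {s} X {i} → OccursAt s (fifthPower X) i → Periodic s (length X) i
fifthPower⇒periodic {s} X {i} occ a i≤a a<i+4p =
  occurs-twice⇒shift-invariant {s} X⁴ (OccursAt-++ˡ {s} X⁴ (subst (λ w → OccursAt s w i) X⁵≡X⁴X occ))
    (OccursAt-++ʳ {s} X occ) a i≤a (subst (λ n → a < i + n) (sym |X⁴|) a<i+4p)
  where
  open ≡-Reasoning
  X⁴ : List Bool
  X⁴ = X ++ X ++ X ++ X
  X⁵≡X⁴X : fifthPower X ≡ X⁴ ++ X
  X⁵≡X⁴X = sym (begin
    (X ++ X ++ X ++ X) ++ X  ≡⟨ ++-assoc X (X ++ X ++ X) X ⟩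
    X ++ (X ++ X ++ X) ++ X  ≡⟨ cong (X ++_) (++-assoc X (X ++ X) X) ⟩
    X ++ X ++ (X ++ X) ++ X  ≡⟨ cong (λ Y → X ++ X ++ Y) (++-assoc X X X) ⟩
    fifthPower X             ∎)
  |X⁴| : length X⁴ ≡ 4 * length X
  |X⁴| = begin
    length X⁴                                      ≡⟨ length-++ X ⟩
    length X + length (X ++ X ++ X)                ≡⟨ cong (length X +_) (length-++ X) ⟩
    length X + (length X + length (X ++ X))        ≡⟨ cong (λ m → length X + (length X + m)) (length-++ X) ⟩
    length X + (length X + (length X + length X))  ≡⟨ cong (λ m → length X + (length X + (length X + m))) (+-identityʳ (length X)) ⟨
    4 * length X                                   ∎

n≤⌈n/2⌉*2 : ∀ n → n ≤ ⌈ n /2⌉ * 2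
n≤⌈n/2⌉*2 zero          = z≤n
n≤⌈n/2⌉*2 (suc zero)    = s≤s z≤n
n≤⌈n/2⌉*2 (suc (suc n)) = s≤s (s≤s (n≤⌈n/2⌉*2 n))

⌈n/2⌉*2≤1+n : ∀ n → ⌈ n /2⌉ * 2 ≤ suc n
⌈n/2⌉*2≤1+n zero          = z≤n
⌈n/2⌉*2≤1+n (suc zero)    = ≤-refl
⌈n/2⌉*2≤1+n (suc (suc n)) = s≤s (s≤s (⌈n/2⌉*2≤1+n n))

<⌈n/2⌉+m⇒*2<n+m*2 : ∀ {a} n m → a < ⌈ n /2⌉ + m → a * 2 < n + m * 2
<⌈n/2⌉+m⇒*2<n+m*2 {a} n m a<⌈n/2⌉+m = ≤-pred (begin
  suc a * 2              ≤⟨ *-monoˡ-≤ 2 a<⌈n/2⌉+m ⟩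
  (⌈ n /2⌉ + m) * 2      ≡⟨ *-distribʳ-+ 2 ⌈ n /2⌉ m ⟩
  ⌈ n /2⌉ * 2 + m * 2    ≤⟨ +-monoˡ-≤ (m * 2) (⌈n/2⌉*2≤1+n n) ⟩
  suc n + m * 2          ∎)
  where open ≤-Reasoning

periodic-half : ∀ {s} → (∀ n → s (n * 2) ≡ s n) → ∀ q i → Periodic s (q * 2) i → Periodic s q ⌈ i /2⌉
periodic-half {s} s-2n q i periodic a ⌈i/2⌉≤a a<⌈i/2⌉+4q = begin
  s a                ≡⟨ s-2n a ⟨
  s (a * 2)          ≡⟨ periodic (a * 2) i≤2a 2a<i+8q ⟩
  s (a * 2 + q * 2)  ≡⟨ cong s (*-distribʳ-+ 2 a q) ⟨
  s ((a + q) * 2)    ≡⟨ s-2n (a + q) ⟩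
  s (a + q)          ∎
  where
  open ≡-Reasoning
  i≤2a : i ≤ a * 2
  i≤2a = ≤-trans (n≤⌈n/2⌉*2 i) (*-monoˡ-≤ 2 ⌈i/2⌉≤a)
  2a<i+8q : a * 2 < i + 4 * (q * 2)
  2a<i+8q = subst (λ m → a * 2 < i + m) (*-assoc 4 q 2) (<⌈n/2⌉+m⇒*2<n+m*2 i (4 * q) a<⌈i/2⌉+4q)

residue-in-window : ∀ n c i → c < suc n → ∃[ k ] (i ≤ c + k * suc n × c + k * suc n < i + suc n)
residue-in-window n c zero c<1+n = 0 , z≤n , subst (_< suc n) (sym (+-identityʳ c)) c<1+n
residue-in-window n c (suc i) c<1+n with residue-in-window n c i c<1+n
... | k , i≤x , x<i+1+n with m≤n⇒m<n∨m≡n i≤x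
...   | inj₁ i<x  = k , i<x , m<n⇒m<1+n x<i+1+n
...   | inj₂ refl = suc k , subst (suc i ≤_) (sym next) (s≤s (m≤n+m i n))
                          , subst (_< suc i + suc n) (sym next) (s≤s (≤-reflexive (+-comm (suc n) i)))
  where
  shift : ∀ c k n → c + (1 + k) * n ≡ n + (c + k * n)
  shift = solve-∀
  next : c + suc k * suc n ≡ suc n + (c + k * suc n)
  next = shift c k (suc n)

periodic⇒Δ≡ : ∀ {s p i a} → Periodic s p i → i ≤ a → suc a < i + 4 * p → Δ s a ≡ Δ s (a + p)
periodic⇒Δ≡ {a = a} periodic i≤a 1+a<i+4p =
  cong₂ _xor_ (periodic a i≤a (<-trans (n<1+n a) 1+a<i+4p)) (periodic (suc a) (m≤n⇒m≤1+n i≤a) 1+a<i+4p)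

Δ-mismatch⇒¬periodic : ∀ {s p i} c → c < 8 → 3 ≤ p →
                       (∀ k → Δ s (c + k * 8) ≢ Δ s (c + k * 8 + p)) → ¬ Periodic s p i
Δ-mismatch⇒¬periodic {p = p} {i} c c<8 3≤p mismatch periodic with residue-in-window 7 c i c<8
... | k , i≤a , a<i+8 = mismatch k (periodic⇒Δ≡ periodic i≤a (begin-strict
  suc (c + k * 8)  <⟨ s≤s a<i+8 ⟩
  suc (i + 8)      ≡⟨ +-suc i 8 ⟨
  i + 9            ≤⟨ +-monoʳ-≤ i (≤-trans (m≤m+n 9 3) (*-monoʳ-≤ 4 3≤p)) ⟩
  i + 4 * p        ∎))
  where open ≤-Reasoning

≡true→≡false→≢ : ∀ {x y} → x ≡ true → y ≡ false → x ≢ y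
≡true→≡false→≢ refl refl ()

¬periodic-1 : ∀ i → ¬ Periodic r 1 i
¬periodic-1 i periodic with residue-in-window 3 0 i (s≤s z≤n)
... | k , i≤a , a<i+4 = not-¬ refl (begin
  r k            ≡⟨ r-4k k ⟨
  r (k * 4)      ≡⟨ periodic (k * 4) i≤a a<i+4 ⟩
  r (k * 4 + 1)  ≡⟨ cong r (+-comm (k * 4) 1) ⟩
  r (1 + k * 4)  ≡⟨ r-4k+1 k ⟩
  not (r k)      ∎)
  where open ≡-Reasoning

¬periodic-8w+9 : ∀ w i → ¬ Periodic r (9 + w * 8) i
¬periodic-8w+9 w i = Δ-mismatch⇒¬periodic 0 (m≤m+n 1 _) (m≤m+n 3 _) λ k →
  ≡true→≡false→≢ (trans (cong (Δ r) (sym (*-assoc k 2 4))) (Δr-4k (k * 2)))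
                 (trans (cong (Δ r) (shift k w)) (Δr-8k+1 (k + suc w)))
  where
  shift : ∀ k w → k * 8 + (9 + w * 8) ≡ 1 + (k + suc w) * 8
  shift = solve-∀

¬periodic-8w+3 : ∀ w i → ¬ Periodic r (3 + w * 8) i
¬periodic-8w+3 w i = Δ-mismatch⇒¬periodic 2 (m≤m+n 3 _) (m≤m+n 3 _) λ k →
  ≢-sym (≡true→≡false→≢ (trans (cong (Δ r) (shift k w)) (Δr-8k+5 (k + w)))
                        (trans (cong (λ m → Δ r (2 + m)) (sym (*-assoc k 2 4))) (Δr-4k+2 (k * 2))))
  where
  shift : ∀ k w → 2 + k * 8 + (3 + w * 8) ≡ 5 + (k + w) * 8
  shift = solve-∀

¬periodic-8w+5 : ∀ w i → ¬ Periodic r (5 + w * 8) i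
¬periodic-8w+5 w i = Δ-mismatch⇒¬periodic 4 (m≤m+n 5 _) (m≤m+n 3 _) λ k →
  ≡true→≡false→≢ (trans (cong (λ m → Δ r (4 + m)) (sym (*-assoc k 2 4))) (Δr-4k (1 + k * 2)))
                 (trans (cong (Δ r) (shift k w)) (Δr-8k+1 (k + suc w)))
  where
  shift : ∀ k w → 4 + k * 8 + (5 + w * 8) ≡ 1 + (k + suc w) * 8
  shift = solve-∀

¬periodic-8w+7 : ∀ w i → ¬ Periodic r (7 + w * 8) i
¬periodic-8w+7 w i = Δ-mismatch⇒¬periodic 6 (m≤m+n 7 _) (m≤m+n 3 _) λ k →
  ≢-sym (≡true→≡false→≢ (trans (cong (Δ r) (shift k w)) (Δr-8k+5 (k + suc w)))
                        (trans (cong (λ m → Δ r (6 + m)) (sym (*-assoc k 2 4))) (Δr-4k+2 (1 + k * 2))))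
  where
  shift : ∀ k w → 6 + k * 8 + (7 + w * 8) ≡ 5 + (k + suc w) * 8
  shift = solve-∀

¬periodic-2q : ∀ {p} q → p ≡ q * 2 → (∀ {q} → q < p → 0 < q → ∀ i → ¬ Periodic r q i) →
               0 < p → ∀ i → ¬ Periodic r p i
¬periodic-2q zero    refl _ () _ _
¬periodic-2q (suc q) refl ¬periodic-below _ i periodic =
  ¬periodic-below (m<m*n (suc q) 2 ≤-refl) (s≤s z≤n) ⌈ i /2⌉ (periodic-half r-2n (suc q) i periodic)

r-aperiodic : ∀ p → 0 < p → ∀ i → ¬ Periodic r p i
r-aperiodic = <-rec (λ p → 0 < p → ∀ i → ¬ Periodic r p i) step
  where
  even-residue : ∀ c w → c * 2 + w * 8 ≡ (c + w * 4) * 2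
  even-residue = solve-∀
  step : ∀ p → (∀ {q} → q < p → 0 < q → ∀ i → ¬ Periodic r q i) → 0 < p → ∀ i → ¬ Periodic r p i
  step p ¬periodic-below 0<p i with p / 8 | p % 8 | m%n<n p 8 | m≡m%n+[m/n]*n p 8
  ... | w     | 0 | _ | p≡ = ¬periodic-2q (w * 4)     (trans p≡ (even-residue 0 w)) ¬periodic-below 0<p i
  ... | w     | 2 | _ | p≡ = ¬periodic-2q (1 + w * 4) (trans p≡ (even-residue 1 w)) ¬periodic-below 0<p i
  ... | w     | 4 | _ | p≡ = ¬periodic-2q (2 + w * 4) (trans p≡ (even-residue 2 w)) ¬periodic-below 0<p i
  ... | w     | 6 | _ | p≡ = ¬periodic-2q (3 + w * 4) (trans p≡ (even-residue 3 w)) ¬periodic-below 0<p i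
  ... | zero  | 1 | _ | refl = ¬periodic-1 i
  ... | suc w | 1 | _ | refl = ¬periodic-8w+9 w i
  ... | w     | 3 | _ | refl = ¬periodic-8w+3 w i
  ... | w     | 5 | _ | refl = ¬periodic-8w+5 w i
  ... | w     | 7 | _ | refl = ¬periodic-8w+7 w i
  ... | _     | suc (suc (suc (suc (suc (suc (suc (suc _))))))) | s≤s (s≤s (s≤s (s≤s (s≤s (s≤s (s≤s (s≤s ()))))))) | _

theorem6 : QuintFree r
theorem6 ([] , X≢[] , _) = X≢[] refl
theorem6 (X@(_ ∷ _) , _ , i , occ) = r-aperiodic (length X) (s≤s z≤n) i (fifthPower⇒periodic X occ)
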